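{- Let $n=p_1^{\alpha_1}\cdots p_k^{\alpha_k}$ be the prime power factorization of $n$ with $k\ge2$, distinct primes $p_i$ and $\alpha_1>\alpha_2>\cdots>\alpha_k\ge1$. Then the automorphism group of $\Upsilon_n$ has order $2$ if $n=p_1^2p_2$, and order $1$ otherwise.
   Context: For an integer $n>1$, a proper divisor of $n$ is an integer $d$ with $1<d<n$ and $d\mid n$. The proper divisor graph $\Upsilon_n$ is the simple graph whose vertices are the proper divisors of $n$, two distinct vertices $u,v$ being adjacent iff $n\mid uv$. -}

module Defs where

open import Data.Nat using (ℕ; zero; suc; _*_; _^_; _<_; _≤_; s≤s; z≤n)
open import Data.Nat.Properties using (≤-trans)
open import Data.Nat.Divisibility using (_∣_)
open import Data.Fin using (Fin; fromℕ<)
import Data.Fin as F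
open import Data.Vec using (Vec; lookup)
open import Data.Product using (Σ; ∃; _×_; proj₁)
open import Relation.Binary.PropositionalEquality using (_≡_; _≢_)
open import Relation.Nullary using (¬_)
open import Function.Bundles using (_⇔_)

ProperDivisor : ℕ → ℕ → Set
ProperDivisor n d = (1 < d) × (d < n) × (d ∣ n)

-- adjacency in the proper divisor graph Υ_n (for distinct vertices u v)
Adjacent : ℕ → ℕ → ℕ → Set
Adjacent n u v = n ∣ (u * v)

-- A graph automorphism of Υ_n, given as a map on ℕ whose restriction
-- to the vertex set (proper divisors of n) is a bijection of the vertex
-- set preserving and reflecting adjacency.
record IsAutomorphism (n : ℕ) (σ : ℕ → ℕ) : Set where
  field
    maps-into  : ∀ d → ProperDivisor n d → ProperDivisor n (σ d)
    injective  : ∀ u v → ProperDivisor n u → ProperDivisor n v → σ u ≡ σ v → u ≡ v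
    surjective : ∀ v → ProperDivisor n v → ∃ λ u → ProperDivisor n u × σ u ≡ v
    adjacency  : ∀ u v → ProperDivisor n u → ProperDivisor n v → u ≢ v →
                 Adjacent n u v ⇔ Adjacent n (σ u) (σ v)

Automorphism : ℕ → Set
Automorphism n = Σ (ℕ → ℕ) (IsAutomorphism n)

SameAut : (n : ℕ) → Automorphism n → Automorphism n → Set
SameAut n f g = ∀ d → ProperDivisor n d → proj₁ f d ≡ proj₁ g d

-- |Aut(Υ_n)| = m : there is a list of m pairwise distinct automorphisms
-- containing (up to equality on vertices) every automorphism.
AutGroupOrder : ℕ → ℕ → Set
AutGroupOrder n m =
  Σ (Vec (Automorphism n) m) λ fs →
    (∀ i j → i ≢ j → ¬ SameAut n (lookup fs i) (lookup fs j)) ×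
    (∀ f → ∃ λ i → SameAut n f (lookup fs i))

∏ : ∀ {k} → (Fin k → ℕ) → ℕ
∏ {zero}  f = 1
∏ {suc k} f = f F.zero * ∏ (λ i → f (F.suc i))

-- the indices 1 and 2 (0-based: 0 and 1) when 2 ≤ k
idx₁ : ∀ {k} → 2 ≤ k → Fin k
idx₁ h = fromℕ< (≤-trans (s≤s z≤n) h)

idx₂ : ∀ {k} → 2 ≤ k → Fin k
idx₂ h = fromℕ< h

-- An automorphism σ of Υ_n preserves complementation u ↦ n/u, since u and n/u are recognised in
-- the graph by the adjacency pattern `Opposite`. As n ∣ u v exactly when n/u ∣ v, σ then preserves
-- divisibility between vertices that are not complementary, and therefore maps primes to primes.
-- The powers p, p², …, p^α of a prime p go to a strictly increasing chain of powers of σ(p),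
-- unless n/p^α is itself prime; so σ can move a prime to one of smaller exponent only when
-- n = p₁²p₂. With distinct exponents this makes σ fix every prime, then every prime power, and
-- hence every vertex. For n = p₁²p₂ the graph is the path p₁ – p₁p₂ – p₁² – p₂, whose only
-- non-trivial automorphism is its reversal.

module Submission where

open import Defs
open import Data.Nat using (ℕ; _^_; _*_; _<_; _≤_)
open import Data.Nat.Primality using (Prime)
open import Data.Fin using (Fin)
open import Data.Product using (_×_)
import Data.Fin as F
open import Relation.Binary.PropositionalEquality using (_≡_; _≢_)

open import Data.Nat
open import Data.Nat.Properties
open import Data.Nat.Divisibility
open import Data.Nat.Primality
open import Data.Nat.Primality.Factorisation using (factorise; PrimeFactorisation)
open import Data.Nat.Coprimality using (Coprime; coprime-divisor)
import Data.Nat.Coprimality as Coprime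
open import Data.Nat.Induction using (<-rec)
import Data.Fin.Properties as Fin
open import Data.Fin.Induction using () renaming (<-wellFounded to Fin-<-wellFounded)
open import Induction.WellFounded using (Acc; acc)
open import Data.List using (_∷_; [])
open import Data.List.Relation.Unary.All using (_∷_)
open import Data.Vec using (Vec; _∷_; []; lookup)
open import Data.Product using (_,_; proj₁; proj₂; ∃-syntax; ∃₂)
open import Data.Sum using (_⊎_; inj₁; inj₂)
import Data.Sum as Sum
open import Function using (_∘_; id)
open import Function.Bundles using (Equivalence; mk⇔)
open import Relation.Nullary using (¬_; yes; no; contradiction)
open import Relation.Binary.PropositionalEquality
open import Relation.Binary.Definitions using (tri<; tri≈; tri>)
open ≡-Reasoning

private variable
  a b c d e j m o r s t u u′ v w x y : ℕ

-- Primes, prime powers and divisibility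

prime>1 : Prime r → 1 < r
prime>1 pr = nonTrivial⇒n>1 _ {{prime⇒nonTrivial pr}}

∣prime⇒≡ : Prime r → 1 < d → d ∣ r → d ≡ r
∣prime⇒≡ pr 1<d d∣r with prime⇒irreducible pr d∣r
... | inj₁ refl = contradiction 1<d (<-irrefl refl)
... | inj₂ d≡r  = d≡r

prime∣prime⇒≡ : Prime t → Prime r → t ∣ r → t ≡ r
prime∣prime⇒≡ pt pr = ∣prime⇒≡ pr (prime>1 pt)

prime∤1 : Prime t → ¬ t ∣ 1
prime∤1 pt t∣1 = ¬prime[1] (subst Prime (∣1⇒≡1 t∣1) pt)

prime∣^⇒≡ : ∀ m → Prime t → Prime r → t ∣ r ^ m → t ≡ r
prime∣^⇒≡ zero    pt pr t∣1 = contradiction t∣1 (prime∤1 pt)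
prime∣^⇒≡ (suc m) pt pr t∣r^1+m with euclidsLemma _ _ pt t∣r^1+m
... | inj₁ t∣r   = prime∣prime⇒≡ pt pr t∣r
... | inj₂ t∣r^m = prime∣^⇒≡ m pt pr t∣r^m

prime-factor : 1 < x → ∃[ t ] Prime t × t ∣ x
prime-factor {x} 1<x = from-factorisation (factorise x {{>-nonZero (<-trans z<s 1<x)}})
  where
  from-factorisation : PrimeFactorisation x → ∃[ t ] Prime t × t ∣ x
  from-factorisation record { factors = [] ; isFactorisation = x≡1 } =
    contradiction x≡1 (>⇒≢ 1<x)
  from-factorisation record { factors = t ∷ _ ; isFactorisation = x≡∏factors ; factorsPrime = pt ∷ _ } =
    t , pt , subst (t ∣_) (sym x≡∏factors) (m∣m*n _)

^-monoʳ-∣ : ∀ r → m ≤ o → r ^ m ∣ r ^ o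
^-monoʳ-∣ {m} {o} r m≤o = divides (r ^ (o ∸ m)) (begin
  r ^ o               ≡⟨ cong (r ^_) (sym (m∸n+n≡m m≤o)) ⟩
  r ^ (o ∸ m + m)     ≡⟨ ^-distribˡ-+-* r (o ∸ m) m ⟩
  r ^ (o ∸ m) * r ^ m ∎)

m∣m^n : ∀ m → 1 ≤ a → m ∣ m ^ a
m∣m^n {a} m 1≤a = subst (_∣ m ^ a) (*-identityʳ m) (^-monoʳ-∣ m 1≤a)

^∣^⇒≤ : 1 < r → r ^ m ∣ r ^ o → m ≤ o
^∣^⇒≤ {r} {m} {o} 1<r r^m∣r^o with m ≤? o
... | yes m≤o = m≤o
... | no  m≰o = contradiction (∣⇒≤ {{m^n≢0 r o {{>-nonZero (<-trans z<s 1<r)}}}} r^m∣r^o)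
                              (<⇒≱ (^-monoʳ-< r 1<r (≰⇒> m≰o)))

^-injectiveʳ : 1 < r → r ^ m ≡ r ^ o → m ≡ o
^-injectiveʳ 1<r eq = ≤-antisym (^∣^⇒≤ 1<r (∣-reflexive eq)) (^∣^⇒≤ 1<r (∣-reflexive (sym eq)))

divisor>0 : x ∣ y → 0 < y → 0 < x
divisor>0 {zero}  0∣y y>0 = contradiction (0∣⇒≡0 0∣y) (>⇒≢ y>0)
divisor>0 {suc _} _   _   = z<s

split-off-prime : Prime r → ∀ x → 0 < x → ∃₂ λ e b → x ≡ r ^ e * b × ¬ r ∣ b
split-off-prime {r} pr = <-rec _ split
  where
  split : ∀ x → (∀ {y} → y < x → 0 < y → ∃₂ λ e b → y ≡ r ^ e * b × ¬ r ∣ b) →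
          0 < x → ∃₂ λ e b → x ≡ r ^ e * b × ¬ r ∣ b
  split x rec x>0 with r ∣? x
  ... | no r∤x = 0 , x , sym (+-identityʳ x) , r∤x
  ... | yes r∣x@(divides q x≡q*r)
    with rec (quotient-< r∣x {{prime⇒nonTrivial pr}} {{>-nonZero x>0}})
             (>-nonZero⁻¹ q {{quotient≢0 r∣x {{>-nonZero x>0}}}})
  ...   | e , b , q≡r^e*b , r∤b = suc e , b , x≡ , r∤b
    where
    x≡ : x ≡ r ^ suc e * b
    x≡ = begin
      x               ≡⟨ x≡q*r ⟩
      q * r           ≡⟨ cong (_* r) q≡r^e*b ⟩
      r ^ e * b * r   ≡⟨ *-comm (r ^ e * b) r ⟩
      r * (r ^ e * b) ≡⟨ *-assoc r (r ^ e) b ⟨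
      r * r ^ e * b   ∎

only-prime-factor⇒^ : Prime r → 0 < x → (∀ t → Prime t → t ∣ x → t ≡ r) → ∃[ e ] x ≡ r ^ e
only-prime-factor⇒^ {r} {x} pr x>0 only with split-off-prime pr x x>0
... | e , zero , x≡r^e*0 , _ = contradiction (trans x≡r^e*0 (*-zeroʳ (r ^ e))) (>⇒≢ x>0)
... | e , 1 , x≡r^e*1 , _ = e , trans x≡r^e*1 (*-identityʳ (r ^ e))
... | e , b@(suc (suc _)) , x≡r^e*b , r∤b with prime-factor {b} (s<s z<s)
...   | t , pt , t∣b with only t pt (∣-trans t∣b (divides (r ^ e) x≡r^e*b))
...     | refl = contradiction t∣b r∤b

∣^⇒^ : Prime r → y ∣ r ^ j → ∃[ f ] y ≡ r ^ f
∣^⇒^ {r} {y} {j} pr y∣r^j = only-prime-factor⇒^ pr y>0 λ t pt t∣y → prime∣^⇒≡ j pt pr (∣-trans t∣y y∣r^j)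
  where
  y>0 : 0 < y
  y>0 = divisor>0 y∣r^j (m^n>0 r {{prime⇒nonZero pr}} j)

prime∤⇒coprime-^ : ∀ e → Prime r → ¬ r ∣ b → Coprime (r ^ e) b
prime∤⇒coprime-^ {r} e pr r∤b (d∣r^e , d∣b) with ∣^⇒^ {j = e} pr d∣r^e
... | zero  , d≡1  = d≡1
... | suc f , refl = contradiction (∣-trans (m∣m*n (r ^ f)) d∣b) r∤b

coprime⇒*∣ : Coprime a b → a ∣ y → b ∣ y → a * b ∣ y
coprime⇒*∣ {a} {b} coprime (divides q refl) b∣q*a
  with coprime-divisor (Coprime.sym coprime) (subst (b ∣_) (*-comm q a) b∣q*a)
... | divides q′ refl = divides q′ (trans (*-assoc q′ b a) (cong (q′ *_) (*-comm b a)))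

prime-powers-∣⇒∣ : ∀ x y → 0 < x → (∀ t e → Prime t → t ^ e ∣ x → t ^ e ∣ y) → x ∣ y
prime-powers-∣⇒∣ = <-rec _ by-prime-powers
  where
  by-prime-powers : ∀ x →
                    (∀ {x′} → x′ < x → ∀ y → 0 < x′ →
                       (∀ t e → Prime t → t ^ e ∣ x′ → t ^ e ∣ y) → x′ ∣ y) →
                  ∀ y → 0 < x → (∀ t e → Prime t → t ^ e ∣ x → t ^ e ∣ y) → x ∣ y
  by-prime-powers 1 _ y _ _ = 1∣ y
  by-prime-powers x@(suc (suc _)) rec y _ powers∣y with prime-factor {x} (s<s z<s)
  ... | t , pt , t∣x with split-off-prime pt x z<s
  ...   | zero , b , x≡1*b , t∤b = contradiction (subst (t ∣_) (trans x≡1*b (*-identityˡ b)) t∣x) t∤b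
  ...   | e@(suc _) , b , x≡t^e*b , t∤b =
    subst (_∣ y) (sym x≡t^e*b) (coprime⇒*∣ (prime∤⇒coprime-^ e pt t∤b) t^e∣y b∣y)
    where
    b∣x : b ∣ x
    b∣x = divides (t ^ e) x≡t^e*b
    t^e∣y : t ^ e ∣ y
    t^e∣y = powers∣y t e pt (divides b (trans x≡t^e*b (*-comm (t ^ e) b)))
    b<x : b < x
    b<x = quotient-< (divides b (trans x≡t^e*b (*-comm (t ^ e) b)))
            {{n>1⇒nonTrivial (^-monoʳ-< t (prime>1 pt) {0} {e} z<s)}}
    b∣y : b ∣ y
    b∣y = rec b<x y (divisor>0 b∣x z<s) λ t′ e′ pt′ d → powers∣y t′ e′ pt′ (∣-trans d b∣x)

m^2≡m*m : ∀ m → m ^ 2 ≡ m * m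
m^2≡m*m m = cong (m *_) (*-identityʳ m)

∣prime*prime : Prime r → d ∣ r * r → d ≡ 1 ⊎ d ≡ r ⊎ d ≡ r * r
∣prime*prime {r} {d} pr d∣rr with ∣^⇒^ {j = 2} pr (subst (d ∣_) (sym (m^2≡m*m r)) d∣rr)
... | 0 , d≡1   = inj₁ d≡1
... | 1 , d≡r   = inj₂ (inj₁ (trans d≡r (*-identityʳ r)))
... | 2 , d≡r^2 = inj₂ (inj₂ (trans d≡r^2 (m^2≡m*m r)))
... | suc (suc (suc f)) , refl =
  contradiction (^∣^⇒≤ {m = 3 + f} {o = 2} (prime>1 pr) (subst (r ^ (3 + f) ∣_) (sym (m^2≡m*m r)) d∣rr))
                λ { (s≤s (s≤s ())) }

^∣^*⇒≤ : Prime r → ¬ r ∣ b → r ^ e ∣ r ^ a * b → e ≤ a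
^∣^*⇒≤ {r} {b} {e} {a} pr r∤b r^e∣r^a*b with e ≤? a
... | yes e≤a = e≤a
... | no  e≰a = contradiction (*-cancelˡ-∣ (r ^ a) {{m^n≢0 r a {{prime⇒nonZero pr}}}} r^a*r∣r^a*b) r∤b
  where
  r^a*r∣r^a*b : r ^ a * r ∣ r ^ a * b
  r^a*r∣r^a*b = ∣-trans (subst (_∣ r ^ e) (*-comm r (r ^ a)) (^-monoʳ-∣ r (≰⇒> e≰a))) r^e∣r^a*b

m*m≡n*n⇒m≡n : a * a ≡ b * b → a ≡ b
m*m≡n*n⇒m≡n {a} {b} eq with <-cmp a b
... | tri< a<b _ _ = contradiction eq (<⇒≢ (*-mono-< a<b a<b))
... | tri≈ _ a≡b _ = a≡b
... | tri> _ _ b<a = contradiction (sym eq) (<⇒≢ (*-mono-< b<a b<a))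

module _ where
  open F using (zero; suc)

  ∏^>0 : ∀ {k} (p α : Fin k → ℕ) → (∀ i → Prime (p i)) → 0 < ∏ (λ i → p i ^ α i)
  ∏^>0 {zero}  p α primes = z<s
  ∏^>0 {suc k} p α primes =
    *-mono-< {0} {p zero ^ α zero} {0} (m^n>0 (p zero) {{prime⇒nonZero (primes zero)}} (α zero))
             (∏^>0 (p ∘ suc) (α ∘ suc) (primes ∘ suc))

  ^∣∏^ : ∀ {k} (p α : Fin k → ℕ) i → p i ^ α i ∣ ∏ (λ i → p i ^ α i)
  ^∣∏^ p α zero    = m∣m*n _
  ^∣∏^ p α (suc i) = ∣n⇒∣m*n (p zero ^ α zero) (^∣∏^ (p ∘ suc) (α ∘ suc) i)

  prime∣∏^⇒≡ : ∀ {k} (p α : Fin k → ℕ) → (∀ i → Prime (p i)) →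
               Prime t → t ∣ ∏ (λ i → p i ^ α i) → ∃[ i ] t ≡ p i
  prime∣∏^⇒≡ {k = zero}  p α primes pt t∣1 = contradiction t∣1 (prime∤1 pt)
  prime∣∏^⇒≡ {k = suc k} p α primes pt t∣∏ with euclidsLemma _ _ pt t∣∏
  ... | inj₁ t∣p₀^α₀ = zero , prime∣^⇒≡ (α zero) pt (primes zero) t∣p₀^α₀
  ... | inj₂ t∣∏tail with prime∣∏^⇒≡ (p ∘ suc) (α ∘ suc) (primes ∘ suc) pt t∣∏tail
  ...   | i , t≡pᵢ = suc i , t≡pᵢ

  ^∣∏^⇒≤ : ∀ {k} (p α : Fin k → ℕ) → (∀ i → Prime (p i)) → (∀ i j → p i ≡ p j → i ≡ j) →
           ∀ i → p i ^ e ∣ ∏ (λ i → p i ^ α i) → e ≤ α i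
  ^∣∏^⇒≤ p α primes injective zero = ^∣^*⇒≤ (primes zero) p₀∤∏tail
    where
    p₀∤∏tail : ¬ p zero ∣ ∏ (λ i → p (suc i) ^ α (suc i))
    p₀∤∏tail p₀∣∏tail with prime∣∏^⇒≡ (p ∘ suc) (α ∘ suc) (primes ∘ suc) (primes zero) p₀∣∏tail
    ... | i , p₀≡pᵢ₊₁ with injective zero (suc i) p₀≡pᵢ₊₁
    ...   | ()
  ^∣∏^⇒≤ {e} p α primes injective (suc i) pᵢ₊₁^e∣∏ =
    ^∣∏^⇒≤ (p ∘ suc) (α ∘ suc) (primes ∘ suc) (λ i j eq → Fin.suc-injective (injective (suc i) (suc j) eq)) i
           (coprime-divisor (prime∤⇒coprime-^ e (primes (suc i)) pᵢ₊₁∤p₀^α₀) pᵢ₊₁^e∣∏)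
    where
    pᵢ₊₁∤p₀^α₀ : ¬ p (suc i) ∣ p zero ^ α zero
    pᵢ₊₁∤p₀^α₀ d with injective (suc i) zero (prime∣^⇒≡ (α zero) (primes (suc i)) (primes zero) d)
    ... | ()

-- Υ_n for n with two distinct prime divisors

id-isAutomorphism : ∀ n → IsAutomorphism n id
id-isAutomorphism n = record
  { maps-into  = λ _ d-vertex → d-vertex
  ; injective  = λ _ _ _ _ u≡v → u≡v
  ; surjective = λ v v-vertex → v , v-vertex , refl
  ; adjacency  = λ _ _ _ _ _ → mk⇔ id id
  }

identity : ∀ n → Automorphism n
identity n = id , id-isAutomorphism n

rigid⇒autGroupOrder1 : ∀ {n} → (∀ f → SameAut n f (identity n)) → AutGroupOrder n 1
rigid⇒autGroupOrder1 {n} rigid = identity n ∷ [] , distinct , λ f → zero , rigid f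
  where
  open F using (zero)
  distinct : ∀ i j → i ≢ j → ¬ SameAut n (lookup (identity n ∷ []) i) (lookup (identity n ∷ []) j)
  distinct zero zero i≢j = contradiction refl i≢j

module ProperDivisorGraph (n : ℕ) {{n≢0 : NonZero n}} {p q : ℕ} (prime-p : Prime p) (prime-q : Prime q)
                          (p≢q : p ≢ q) (p∣n : p ∣ n) (q∣n : q ∣ n) where

  Vertex : ℕ → Set
  Vertex = ProperDivisor n

  infix 4 _~_
  _~_ : ℕ → ℕ → Set
  u ~ v = u ≢ v × Adjacent n u v

  adjacent-sym : ∀ u v → Adjacent n u v → Adjacent n v u
  adjacent-sym u v = subst (n ∣_) (*-comm u v)

  ~-sym : u ~ v → v ~ u
  ~-sym {u} {v} (u≢v , n∣uv) = u≢v ∘ sym , adjacent-sym u v n∣uv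

  vertex>1 : Vertex u → 1 < u
  vertex>1 = proj₁

  vertex>0 : Vertex u → 0 < u
  vertex>0 (1<u , _) = <-trans z<s 1<u

  vertex∣n : Vertex u → u ∣ n
  vertex∣n = proj₂ ∘ proj₂

  vertex≢0 : Vertex u → NonZero u
  vertex≢0 (1<u , _) = >-nonZero (<-trans z<s 1<u)

  divisor-vertex : 1 < d → d ∣ u → Vertex u → Vertex d
  divisor-vertex {d} {u} 1<d d∣u (1<u , u<n , u∣n) =
    1<d , ≤-<-trans (∣⇒≤ {{>-nonZero (<-trans z<s 1<u)}} d∣u) u<n , ∣-trans d∣u u∣n

  n∤prime^ : Prime r → ¬ n ∣ r ^ m
  n∤prime^ {r} {m} pr n∣r^m =
    p≢q (trans (prime∣^⇒≡ m prime-p pr (∣-trans p∣n n∣r^m))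
               (sym (prime∣^⇒≡ m prime-q pr (∣-trans q∣n n∣r^m))))

  ^*^≢n : Prime r → r ^ a * r ^ b ≢ n
  ^*^≢n {r} {a} {b} pr r^a*r^b≡n =
    n∤prime^ {m = a + b} pr (∣-reflexive (trans (sym r^a*r^b≡n) (sym (^-distribˡ-+-* r a b))))

  ^*prime≢n : Prime t → Prime r → t ^ suc j ∣ n → t ^ j * r ≢ n
  ^*prime≢n {t} {r} {j} pt pr t^1+j∣n t^j*r≡n = n∤prime^ {m = suc j} pt (∣-reflexive (begin
    n         ≡⟨ t^j*r≡n ⟨
    t ^ j * r ≡⟨ cong (t ^ j *_) t≡r ⟨
    t ^ j * t ≡⟨ *-comm (t ^ j) t ⟩
    t ^ suc j ∎))
    where
    t∣r : t ∣ r
    t∣r = *-cancelˡ-∣ (t ^ j) {{m^n≢0 t j {{prime⇒nonZero pt}}}}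
            (subst₂ _∣_ (*-comm t (t ^ j)) (sym t^j*r≡n) t^1+j∣n)
    t≡r : t ≡ r
    t≡r = prime∣prime⇒≡ pt pr t∣r

  power-vertex : Prime r → 1 ≤ a → a ≤ b → Vertex (r ^ b) → Vertex (r ^ a)
  power-vertex {r} pr 1≤a a≤b = divisor-vertex (^-monoʳ-< r (prime>1 pr) 1≤a) (^-monoʳ-∣ r a≤b)

  base-vertex : Prime r → 1 ≤ a → Vertex (r ^ a) → Vertex r
  base-vertex {r} pr 1≤a = divisor-vertex (prime>1 pr) (m∣m^n r 1≤a)

  prime-power-vertex : Prime r → 1 ≤ a → r ^ a ∣ n → Vertex (r ^ a)
  prime-power-vertex {r} {a} pr 1≤a r^a∣n =
    ^-monoʳ-< r (prime>1 pr) 1≤a ,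
    ≤∧≢⇒< (∣⇒≤ r^a∣n) (λ r^a≡n → n∤prime^ {m = a} pr (∣-reflexive (sym r^a≡n))) ,
    r^a∣n

  prime-vertex : Prime r → r ∣ n → Vertex r
  prime-vertex {r} pr r∣n =
    subst Vertex (*-identityʳ r) (prime-power-vertex pr ≤-refl (subst (_∣ n) (sym (*-identityʳ r)) r∣n))

  other-prime : ∀ d → ∃[ s ] Prime s × s ∣ n × s ≢ d
  other-prime d with p ≟ d
  ... | no  p≢d  = p , prime-p , p∣n , p≢d
  ... | yes refl = q , prime-q , q∣n , p≢q ∘ sym

  complement : Vertex u → ∃[ v ] Vertex v × u * v ≡ n
  complement (1<u , u<n , u∣n) =
    quotient u∣n ,
    (quotient>1 u∣n u<n , quotient-< u∣n {{n>1⇒nonTrivial 1<u}} , quotient-∣ u∣n) ,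
    sym (m∣n⇒n≡m*quotient u∣n)

  complement-unique : Vertex u → u * v ≡ n → u * w ≡ n → v ≡ w
  complement-unique {u} {v} {w} u-vertex uv≡n uw≡n = *-cancelˡ-≡ v w u {{vertex≢0 u-vertex}} (trans uv≡n (sym uw≡n))

  adjacent-complement⇒∣ : u * u′ ≡ n → n ∣ u′ * b → u ∣ b
  adjacent-complement⇒∣ {u} {u′} {b} uu′≡n n∣u′b =
    *-cancelˡ-∣ u′ {{m*n≢0⇒n≢0 u {{subst NonZero (sym uu′≡n) n≢0}}}}
      (subst (_∣ u′ * b) (trans (sym uu′≡n) (*-comm u u′)) n∣u′b)

  ∣⇒adjacent-complement : u * u′ ≡ n → u ∣ b → n ∣ u′ * b
  ∣⇒adjacent-complement {u} {u′} {b} uu′≡n u∣b =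
    subst (_∣ u′ * b) (trans (*-comm u′ u) uu′≡n) (*-monoʳ-∣ u′ u∣b)

  ~-complement : u * u ≢ n → u * w ≡ n → u ~ w
  ~-complement {u} {w} uu≢n uw≡n = (λ { refl → uu≢n uw≡n }) , subst (n ∣_) (sym uw≡n) ∣-refl

  Opposite : ℕ → ℕ → Set
  Opposite u v = Vertex u × Vertex v × u ~ v ×
                 (∀ {x y} → Vertex x → Vertex y → u ~ x → v ~ y → x ≡ y ⊎ x ~ y)

  opposite-sym : Opposite u v → Opposite v u
  opposite-sym (u-vertex , v-vertex , u~v , linked) =
    v-vertex , u-vertex , ~-sym u~v ,
    λ x-vertex y-vertex v~x u~y → Sum.map sym ~-sym (linked y-vertex x-vertex u~y v~x)

  complement⇒opposite : Vertex u → Vertex v → u * v ≡ n → u ≢ v → Opposite u v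
  complement⇒opposite {u} {v} u-vertex v-vertex uv≡n u≢v =
    u-vertex , v-vertex , (u≢v , subst (n ∣_) (sym uv≡n) ∣-refl) , linked
    where
    vu≡n : v * u ≡ n
    vu≡n = trans (*-comm v u) uv≡n
    linked : ∀ {x y} → Vertex x → Vertex y → u ~ x → v ~ y → x ≡ y ⊎ x ~ y
    linked {x} {y} _ _ (_ , n∣ux) (_ , n∣vy) with x ≟ y
    ... | yes x≡y = inj₁ x≡y
    ... | no  x≢y = inj₂ (x≢y , subst (_∣ x * y) vu≡n
                      (*-pres-∣ (adjacent-complement⇒∣ {v} {u} {x} vu≡n n∣ux)
                                (adjacent-complement⇒∣ {u} {v} {y} uv≡n n∣vy)))

  -- Writing u = t √n, comparing n/u with the neighbours √n s of √n forces t = s for every prime s ∣ n.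
  ¬opposite-√n : v * v ≡ n → ¬ Opposite u v
  ¬opposite-√n {v} {u} vv≡n (u-vertex , v-vertex , (u≢v , n∣uv) , linked)
    with complement u-vertex | adjacent-complement⇒∣ {v} {v} {u} vv≡n (subst (n ∣_) (*-comm u v) n∣uv)
  ... | w , w-vertex , uw≡n | v∣u@(divides t u≡t*v) = p≢q (trans (sym (t≡ prime-p p∣n)) (t≡ prime-q q∣n))
    where
    instance
      _ = vertex≢0 u-vertex
      _ = vertex≢0 v-vertex

    u~w : u ~ w
    u~w = ~-complement (λ uu≡n → u≢v (m*m≡n*n⇒m≡n (trans uu≡n (sym vv≡n)))) uw≡n

    t≡ : Prime s → s ∣ n → t ≡ s
    t≡ {s} ps s∣n = Sum.[ (λ t≡1 → contradiction (u≡v t≡1) u≢v) , id ]′ (prime⇒irreducible ps t∣s)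
      where
      u≡v : t ≡ 1 → u ≡ v
      u≡v refl = trans u≡t*v (*-identityˡ v)
      s∣v : s ∣ v
      s∣v = Sum.[ id , id ]′ (euclidsLemma v v ps (subst (s ∣_) (sym vv≡n) s∣n))
      v<vs : v < v * s
      v<vs = m<m*n v s (prime>1 ps)
      vs∣n : v * s ∣ n
      vs∣n = subst (v * s ∣_) vv≡n (*-monoʳ-∣ v s∣v)
      vs≢n : v * s ≢ n
      vs≢n vs≡n = n∤prime^ {m = 2} (subst Prime s≡v ps)
                    (∣-reflexive (trans (sym vv≡n) (cong (v *_) (sym (*-identityʳ v)))))
        where
        s≡v : s ≡ v
        s≡v = *-cancelˡ-≡ s v v (trans vs≡n (sym vv≡n))
      vs-vertex : Vertex (v * s)
      vs-vertex = <-trans (vertex>1 v-vertex) v<vs , ≤∧≢⇒< (∣⇒≤ vs∣n) vs≢n , vs∣n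
      v~vs : v ~ v * s
      v~vs = <⇒≢ v<vs , subst (_∣ v * (v * s)) vv≡n (*-monoʳ-∣ v (m∣m*n s))
      u∣vs : u ∣ v * s
      u∣vs with linked w-vertex vs-vertex u~w v~vs
      ... | inj₂ (_ , n∣w·vs) = adjacent-complement⇒∣ {u} {w} {v * s} uw≡n n∣w·vs
      ... | inj₁ refl = contradiction (trans uw≡n (sym vv≡n)) (>⇒≢ (≤-<-trans vv≤uv (*-monoʳ-< u v<vs)))
        where
        vv≤uv : v * v ≤ u * v
        vv≤uv = *-monoˡ-≤ v (∣⇒≤ v∣u)
      t∣s : t ∣ s
      t∣s = *-cancelʳ-∣ v (subst₂ _∣_ u≡t*v (*-comm v s) u∣vs)

  opposite⇒complement : Opposite u v → u * v ≡ n
  opposite⇒complement {u} {v} opposite@(u-vertex , v-vertex , (u≢v , n∣uv) , linked)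
    with u * u ≟ n | v * v ≟ n
  ... | yes uu≡n | _        = contradiction (opposite-sym opposite) (¬opposite-√n uu≡n)
  ... | no _     | yes vv≡n = contradiction opposite (¬opposite-√n vv≡n)
  ... | no uu≢n  | no vv≢n
    with complement u-vertex | complement v-vertex
  ...   | w , w-vertex , uw≡n | z , z-vertex , vz≡n
    with linked w-vertex z-vertex (~-complement uu≢n uw≡n) (~-complement vv≢n vz≡n)
  ...     | inj₁ refl = contradiction (*-cancelʳ-≡ u v w {{vertex≢0 w-vertex}} (trans uw≡n (sym vz≡n))) u≢v
  ...     | inj₂ (_ , n∣wz) = subst (λ c → c * v ≡ n) z≡u (trans (*-comm z v) vz≡n)
    where
    z≡u : z ≡ u
    z≡u = ∣-antisym (adjacent-complement⇒∣ {z} {v} {u} (trans (*-comm z v) vz≡n) (subst (n ∣_) (*-comm u v) n∣uv))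
                    (adjacent-complement⇒∣ {u} {w} {z} uw≡n n∣wz)

  prime∣cofactor : Prime s → s ∣ n → a * b ≡ n → a ∣ b → s ∣ b
  prime∣cofactor {s} {a} {b} ps s∣n ab≡n a∣b with euclidsLemma a b ps (subst (s ∣_) (sym ab≡n) s∣n)
  ... | inj₁ s∣a = ∣-trans s∣a a∣b
  ... | inj₂ s∣b = s∣b

  prime-criterion : Vertex x → (∀ {s} → Prime s → s ∣ x → s * x ≢ n → x ≡ s) → Prime x
  prime-criterion {x} x-vertex x≡factor with prime-factor (vertex>1 x-vertex)
  ... | s , ps , s∣x with s * x ≟ n
  ...   | no  sx≢n = subst Prime (sym (x≡factor ps s∣x sx≢n)) ps
  ...   | yes sx≡n with other-prime s
  ...     | s′ , ps′ , s′∣n , s′≢s =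
    subst Prime (sym (x≡factor ps′ (prime∣cofactor ps′ s′∣n sx≡n s∣x) s′x≢n)) ps′
    where
    s′x≢n : s′ * x ≢ n
    s′x≢n s′x≡n = s′≢s (*-cancelʳ-≡ s′ s x {{vertex≢0 x-vertex}} (trans s′x≡n (sym sx≡n)))

  module Automorphism {σ : ℕ → ℕ} (isAutomorphism : IsAutomorphism n σ) where
    open IsAutomorphism isAutomorphism

    σ-vertex : Vertex u → Vertex (σ u)
    σ-vertex = maps-into _

    σ-injective : Vertex u → Vertex v → σ u ≡ σ v → u ≡ v
    σ-injective = injective _ _

    ~-preserved : Vertex u → Vertex v → u ~ v → σ u ~ σ v
    ~-preserved u-vertex v-vertex (u≢v , n∣uv) =
      u≢v ∘ σ-injective u-vertex v-vertex , Equivalence.to (adjacency _ _ u-vertex v-vertex u≢v) n∣uv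

    ~-reflected : Vertex u → Vertex v → σ u ~ σ v → u ~ v
    ~-reflected {u} {v} u-vertex v-vertex (σu≢σv , n∣σuσv) =
      u≢v , Equivalence.from (adjacency _ _ u-vertex v-vertex u≢v) n∣σuσv
      where
      u≢v : u ≢ v
      u≢v = σu≢σv ∘ cong σ

    opposite-preserved : Opposite u v → Opposite (σ u) (σ v)
    opposite-preserved {u} {v} (u-vertex , v-vertex , u~v , linked) =
      σ-vertex u-vertex , σ-vertex v-vertex , ~-preserved u-vertex v-vertex u~v , linked′
      where
      linked′ : ∀ {x y} → Vertex x → Vertex y → σ u ~ x → σ v ~ y → x ≡ y ⊎ x ~ y
      linked′ x-vertex y-vertex σu~x σv~y with surjective _ x-vertex | surjective _ y-vertex
      ... | x′ , x′-vertex , refl | y′ , y′-vertex , refl =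
        Sum.map (cong σ) (~-preserved x′-vertex y′-vertex)
          (linked x′-vertex y′-vertex (~-reflected u-vertex x′-vertex σu~x) (~-reflected v-vertex y′-vertex σv~y))

    distinct-complement-preserved : Vertex u → Vertex v → u * v ≡ n → u ≢ v → σ u * σ v ≡ n
    distinct-complement-preserved u-vertex v-vertex uv≡n u≢v =
      opposite⇒complement (opposite-preserved (complement⇒opposite u-vertex v-vertex uv≡n u≢v))

    √n-preserved : Vertex u → u * u ≡ n → σ u * σ u ≡ n
    √n-preserved {u} u-vertex uu≡n with complement (σ-vertex u-vertex)
    ... | w , w-vertex , σu·w≡n with w ≟ σ u
    ...   | yes refl = σu·w≡n
    ...   | no  w≢σu with surjective w w-vertex
    ...     | w′ , w′-vertex , refl with complement w′-vertex
    ...       | w″ , w″-vertex , w′w″≡n = contradiction (cong σ w′≡u) w≢σu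
      where
      w′≡u : w′ ≡ u
      w′≡u with w′ ≟ w″
      ... | yes refl = m*m≡n*n⇒m≡n (trans w′w″≡n (sym uu≡n))
      ... | no  w′≢w″ = *-cancelʳ-≡ w′ u u {{vertex≢0 u-vertex}}
                          (trans (subst (λ c → w′ * c ≡ n) w″≡u w′w″≡n) (sym uu≡n))
        where
        w″≡u : w″ ≡ u
        w″≡u = σ-injective w″-vertex u-vertex
                 (complement-unique (σ-vertex w′-vertex)
                    (distinct-complement-preserved w′-vertex w″-vertex w′w″≡n w′≢w″)
                    (trans (*-comm (σ w′) (σ u)) σu·w≡n))

    complement-preserved : Vertex u → Vertex v → u * v ≡ n → σ u * σ v ≡ n
    complement-preserved {u} {v} u-vertex v-vertex uv≡n with u ≟ v
    ... | yes refl = √n-preserved u-vertex uv≡n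
    ... | no  u≢v  = distinct-complement-preserved u-vertex v-vertex uv≡n u≢v

    ∣-preserved : Vertex a → Vertex b → a * b ≢ n → a ∣ b → σ a ∣ σ b
    ∣-preserved {a} {b} a-vertex b-vertex ab≢n a∣b with complement a-vertex
    ... | a′ , a′-vertex , aa′≡n =
      adjacent-complement⇒∣ {σ a} {σ a′} {σ b} (complement-preserved a-vertex a′-vertex aa′≡n)
        (proj₂ (~-preserved a′-vertex b-vertex (a′≢b , ∣⇒adjacent-complement aa′≡n a∣b)))
      where
      a′≢b : a′ ≢ b
      a′≢b refl = ab≢n aa′≡n

    ∣-reflected : Vertex a → Vertex b → a * b ≢ n → σ a ∣ σ b → a ∣ b
    ∣-reflected {a} {b} a-vertex b-vertex ab≢n σa∣σb with complement a-vertex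
    ... | a′ , a′-vertex , aa′≡n =
      adjacent-complement⇒∣ aa′≡n
        (proj₂ (~-reflected a′-vertex b-vertex
          (a′≢b ∘ σ-injective a′-vertex b-vertex ,
           ∣⇒adjacent-complement {σ a} {σ a′} {σ b} (complement-preserved a-vertex a′-vertex aa′≡n) σa∣σb)))
      where
      a′≢b : a′ ≢ b
      a′≢b refl = ab≢n aa′≡n

    prime-preserved : Vertex u → Prime u → Prime (σ u)
    prime-preserved {u} u-vertex pu = prime-criterion (σ-vertex u-vertex) σu≡factor
      where
      σu≡factor : Prime s → s ∣ σ u → s * σ u ≢ n → σ u ≡ s
      σu≡factor {s} ps s∣σu sσu≢n with surjective _ (prime-vertex ps (∣-trans s∣σu (vertex∣n (σ-vertex u-vertex))))
      ... | s′ , s′-vertex , refl = cong σ (sym (∣prime⇒≡ pu (vertex>1 s′-vertex) s′∣u))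
        where
        s′∣u : s′ ∣ u
        s′∣u = ∣-reflected s′-vertex u-vertex (sσu≢n ∘ complement-preserved s′-vertex u-vertex) s∣σu

    prime-reflected : Vertex u → Prime (σ u) → Prime u
    prime-reflected {u} u-vertex pσu = prime-criterion u-vertex u≡factor
      where
      u≡factor : Prime s → s ∣ u → s * u ≢ n → u ≡ s
      u≡factor {s} ps s∣u su≢n =
        sym (σ-injective s-vertex u-vertex
               (∣prime⇒≡ pσu (vertex>1 (σ-vertex s-vertex)) (∣-preserved s-vertex u-vertex su≢n s∣u)))
        where
        s-vertex : Vertex s
        s-vertex = prime-vertex ps (∣-trans s∣u (vertex∣n u-vertex))

    σ-prime-power : Prime r → 1 ≤ j → Vertex (r ^ j) → (∀ {c} → r ^ j * c ≡ n → ¬ Prime c) →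
                    ∃[ e ] σ (r ^ j) ≡ σ r ^ e
    σ-prime-power {r} {j} pr 1≤j x-vertex cofactor-composite =
      only-prime-factor⇒^ (prime-preserved r-vertex pr) (vertex>0 (σ-vertex x-vertex)) only-σr
      where
      r-vertex : Vertex r
      r-vertex = base-vertex pr 1≤j x-vertex
      only-σr : ∀ t → Prime t → t ∣ σ (r ^ j) → t ≡ σ r
      only-σr t pt t∣σx with surjective t (prime-vertex pt (∣-trans t∣σx (vertex∣n (σ-vertex x-vertex))))
      ... | t′ , t′-vertex , refl = cong σ (prime∣^⇒≡ j pt′ pr t′∣x)
        where
        pt′ : Prime t′
        pt′ = prime-reflected t′-vertex pt
        t′∣x : t′ ∣ r ^ j
        t′∣x = ∣-reflected t′-vertex x-vertex
                 (λ t′x≡n → cofactor-composite (trans (*-comm (r ^ j) t′) t′x≡n) pt′) t∣σx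

    σ-prime-power-exponent : Prime r → 1 ≤ j → Vertex (r ^ j) →
                             (∀ {i} → 1 ≤ i → i ≤ j → ∃[ e ] σ (r ^ i) ≡ σ r ^ e) →
                             ∃[ e ] σ (r ^ j) ≡ σ r ^ e × j ≤ e
    σ-prime-power-exponent {r} {1} pr _ x-vertex powers with powers ≤-refl ≤-refl
    ... | zero  , σx≡1 = contradiction (vertex>1 (σ-vertex x-vertex)) (<-irrefl (sym σx≡1))
    ... | suc e , σx≡  = suc e , σx≡ , s≤s z≤n
    σ-prime-power-exponent {r} {suc j@(suc _)} pr _ x-vertex powers =
      step (σ-prime-power-exponent pr (s≤s z≤n) y-vertex (λ 1≤i i≤j → powers 1≤i (m≤n⇒m≤1+n i≤j)))
           (powers (s≤s z≤n) ≤-refl)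
      where
      y-vertex : Vertex (r ^ j)
      y-vertex = power-vertex pr (s≤s z≤n) (n≤1+n j) x-vertex
      1<σr : 1 < σ r
      1<σr = vertex>1 (σ-vertex (base-vertex {a = suc j} pr (s≤s z≤n) x-vertex))
      step : ∃[ e₁ ] σ (r ^ j) ≡ σ r ^ e₁ × j ≤ e₁ → ∃[ e ] σ (r ^ suc j) ≡ σ r ^ e →
             ∃[ e ] σ (r ^ suc j) ≡ σ r ^ e × suc j ≤ e
      step (e₁ , σy≡ , j≤e₁) (e , σx≡) = e , σx≡ , ≤-trans (s≤s j≤e₁) (≤∧≢⇒< e₁≤e e₁≢e)
        where
        e₁≤e : e₁ ≤ e
        e₁≤e = ^∣^⇒≤ 1<σr (subst₂ _∣_ σy≡ σx≡
                 (∣-preserved y-vertex x-vertex (^*^≢n {a = j} {b = suc j} pr) (^-monoʳ-∣ r (n≤1+n j))))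
        e₁≢e : e₁ ≢ e
        e₁≢e refl = <-irrefl (^-injectiveʳ (prime>1 pr) (σ-injective y-vertex x-vertex (trans σy≡ (sym σx≡)))) (n<1+n j)

    σ-fixes-power-above : Prime r → Vertex (r ^ j) → σ (r ^ j) ≡ r ^ e → j ≤ e →
                          (∀ {i} → i < j → 1 ≤ i → σ (r ^ i) ≡ r ^ i) → σ (r ^ j) ≡ r ^ j
    σ-fixes-power-above {r} {j} {e} pr x-vertex σx≡r^e j≤e fixed-below with surjective (r ^ j) x-vertex
    ... | y , y-vertex , σy≡x = fixed (∣^⇒^ {j = j} pr y∣x)
      where
      yx≢n : y * r ^ j ≢ n
      yx≢n yx≡n = ^*^≢n {a = j} {b = e} pr
                    (trans (cong₂ _*_ (sym σy≡x) (sym σx≡r^e)) (complement-preserved y-vertex x-vertex yx≡n))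
      y∣x : y ∣ r ^ j
      y∣x = ∣-reflected y-vertex x-vertex yx≢n (subst₂ _∣_ (sym σy≡x) (sym σx≡r^e) (^-monoʳ-∣ r j≤e))
      fixed : ∃[ f ] y ≡ r ^ f → σ (r ^ j) ≡ r ^ j
      fixed (f , y≡r^f) with f ≟ j
      ... | yes refl = trans (cong σ (sym y≡r^f)) σy≡x
      ... | no  f≢j  = contradiction (^-injectiveʳ (prime>1 pr) r^f≡r^j) f≢j
        where
        1≤f : 1 ≤ f
        1≤f = n≢0⇒n>0 λ f≡0 → <-irrefl (sym (trans y≡r^f (cong (r ^_) f≡0))) (vertex>1 y-vertex)
        f<j : f < j
        f<j = ≤∧≢⇒< (^∣^⇒≤ (prime>1 pr) (subst (_∣ r ^ j) y≡r^f y∣x)) f≢j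
        r^f≡r^j : r ^ f ≡ r ^ j
        r^f≡r^j = trans (sym (fixed-below f<j 1≤f)) (trans (cong σ (sym y≡r^f)) σy≡x)

    σ-fixes-complement : Vertex x → σ x ≡ x → Vertex d → x * d ≡ n → σ d ≡ d
    σ-fixes-complement {x} {d} x-vertex σx≡x d-vertex xd≡n =
      complement-unique x-vertex (subst (λ y → y * σ d ≡ n) σx≡x (complement-preserved x-vertex d-vertex xd≡n)) xd≡n

    fixed-∣-preserved : Vertex x → σ x ≡ x → Vertex d → x ∣ d → x ∣ σ d
    fixed-∣-preserved {x} {d} x-vertex σx≡x d-vertex x∣d with x * d ≟ n
    ... | yes xd≡n = subst (x ∣_) (sym (σ-fixes-complement x-vertex σx≡x d-vertex xd≡n)) x∣d
    ... | no  xd≢n = subst (_∣ σ d) σx≡x (∣-preserved x-vertex d-vertex xd≢n x∣d)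

    fixed-∣-reflected : Vertex x → σ x ≡ x → Vertex d → x ∣ σ d → x ∣ d
    fixed-∣-reflected {x} {d} x-vertex σx≡x d-vertex x∣σd with x * d ≟ n
    ... | yes xd≡n = subst (x ∣_) (σ-fixes-complement x-vertex σx≡x d-vertex xd≡n) x∣σd
    ... | no  xd≢n = ∣-reflected x-vertex d-vertex xd≢n (subst (_∣ σ d) (sym σx≡x) x∣σd)

    fixing-prime-powers⇒fixing-vertices : (∀ t e → Prime t → 1 ≤ e → t ^ e ∣ n → σ (t ^ e) ≡ t ^ e) →
                                          Vertex d → σ d ≡ d
    fixing-prime-powers⇒fixing-vertices {d} fixes d-vertex =
      ∣-antisym (prime-powers-∣⇒∣ (σ d) d (vertex>0 (σ-vertex d-vertex)) reflected)
                (prime-powers-∣⇒∣ d (σ d) (vertex>0 d-vertex) preserved)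
      where
      preserved : ∀ t e → Prime t → t ^ e ∣ d → t ^ e ∣ σ d
      preserved t zero    _  _      = 1∣ σ d
      preserved t (suc e) pt t^e∣d  =
        fixed-∣-preserved (prime-power-vertex {a = suc e} pt (s≤s z≤n) t^e∣n) (fixes t (suc e) pt (s≤s z≤n) t^e∣n)
                          d-vertex t^e∣d
        where
        t^e∣n : t ^ suc e ∣ n
        t^e∣n = ∣-trans t^e∣d (vertex∣n d-vertex)
      reflected : ∀ t e → Prime t → t ^ e ∣ σ d → t ^ e ∣ d
      reflected t zero    _  _       = 1∣ d
      reflected t (suc e) pt t^e∣σd =
        fixed-∣-reflected (prime-power-vertex {a = suc e} pt (s≤s z≤n) t^e∣n) (fixes t (suc e) pt (s≤s z≤n) t^e∣n)
                          d-vertex t^e∣σd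
        where
        t^e∣n : t ^ suc e ∣ n
        t^e∣n = ∣-trans t^e∣σd (vertex∣n (σ-vertex d-vertex))

  same-on-complement : ∀ {σ τ} → IsAutomorphism n σ → IsAutomorphism n τ →
                       Vertex a → Vertex b → a * b ≡ n → σ b ≡ τ b → σ a ≡ τ a
  same-on-complement {a} {b} {σ} {τ} σ-automorphism τ-automorphism a-vertex b-vertex ab≡n σb≡τb =
    *-cancelʳ-≡ (σ a) (τ a) (τ b) {{vertex≢0 (τ.σ-vertex b-vertex)}}
      (trans (subst (λ c → σ a * c ≡ n) σb≡τb (σ.complement-preserved a-vertex b-vertex ab≡n))
             (sym (τ.complement-preserved a-vertex b-vertex ab≡n)))
    where
    module σ = Automorphism σ-automorphism
    module τ = Automorphism τ-automorphism

-- The exceptional case n = p²q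

transpose : ℕ → ℕ → ℕ → ℕ
transpose a b x with x ≟ a | x ≟ b
... | yes _ | _     = b
... | no _  | yes _ = a
... | no _  | no _  = x

transpose-fromˡ : ∀ a b → transpose a b a ≡ b
transpose-fromˡ a b with a ≟ a
... | yes _   = refl
... | no  a≢a = contradiction refl a≢a

transpose-fromʳ : a ≢ b → transpose a b b ≡ a
transpose-fromʳ {a} {b} a≢b with b ≟ a | b ≟ b
... | yes b≡a | _       = contradiction (sym b≡a) a≢b
... | no _    | yes _   = refl
... | no _    | no  b≢b = contradiction refl b≢b

transpose-other : x ≢ a → x ≢ b → transpose a b x ≡ x
transpose-other {x} {a} {b} x≢a x≢b with x ≟ a | x ≟ b
... | yes x≡a | _       = contradiction x≡a x≢a
... | no _    | yes x≡b = contradiction x≡b x≢b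
... | no _    | no _    = refl

module ProperDivisorGraphOfP²Q {P Q : ℕ} (prime-P : Prime P) (prime-Q : Prime Q) (P≢Q : P ≢ Q) where

  instance
    P≢0 : NonZero P
    P≢0 = prime⇒nonZero prime-P
    Q≢0 : NonZero Q
    Q≢0 = prime⇒nonZero prime-Q

  n : ℕ
  n = P * P * Q

  instance
    PP≢0 : NonZero (P * P)
    PP≢0 = m*n≢0 P P
    PQ≢0 : NonZero (P * Q)
    PQ≢0 = m*n≢0 P Q
    n≢0 : NonZero n
    n≢0 = m*n≢0 (P * P) Q

  open ProperDivisorGraph n prime-P prime-Q P≢Q (∣m⇒∣m*n Q (m∣m*n P)) (n∣m*n (P * P))

  n≡P*PQ : n ≡ P * (P * Q)
  n≡P*PQ = *-assoc P P Q

  n≡PQ*P : n ≡ P * Q * P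
  n≡PQ*P = trans n≡P*PQ (*-comm P (P * Q))

  n≡Q^1*PP : n ≡ Q ^ 1 * (P * P)
  n≡Q^1*PP = trans (*-comm (P * P) Q) (cong (_* (P * P)) (sym (*-identityʳ Q)))

  -- Υ_{P²Q} is the path P – PQ – P² – Q, and swap reverses it.
  data PathVertex : ℕ → Set where
    [p]  : PathVertex P
    [q]  : PathVertex Q
    [pp] : PathVertex (P * P)
    [pq] : PathVertex (P * Q)

  P<PP : P < P * P
  P<PP = m<m*n P P (prime>1 prime-P)

  P<PQ : P < P * Q
  P<PQ = m<m*n P Q (prime>1 prime-Q)

  Q<PQ : Q < P * Q
  Q<PQ = subst (Q <_) (*-comm Q P) (m<m*n Q P (prime>1 prime-P))

  Q≢PP : Q ≢ P * P
  Q≢PP Q≡PP = P≢Q (∣prime⇒≡ prime-Q (prime>1 prime-P) (subst (P ∣_) (sym Q≡PP) (m∣m*n P)))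

  PP≢PQ : P * P ≢ P * Q
  PP≢PQ = P≢Q ∘ *-cancelˡ-≡ P Q P

  path-vertex : PathVertex d → Vertex d
  path-vertex [p]  = prime-vertex prime-P (∣m⇒∣m*n Q (m∣m*n P))
  path-vertex [q]  = prime-vertex prime-Q (n∣m*n (P * P))
  path-vertex [pp] = <-trans (prime>1 prime-P) P<PP , m<m*n (P * P) Q (prime>1 prime-Q) , m∣m*n Q
  path-vertex [pq] = <-trans (prime>1 prime-P) P<PQ , subst (P * Q <_) (sym n≡PQ*P) (m<m*n (P * Q) P (prime>1 prime-P)) ,
                     divides P n≡P*PQ

  vertex⇒path-vertex : Vertex d → PathVertex d
  vertex⇒path-vertex {d} (1<d , d<n , d∣n) with Q ∣? d
  ... | no Q∤d
    with ∣prime*prime prime-P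
           (coprime-divisor (Coprime.sym (prime∤⇒coprime-^ 1 prime-Q Q∤d)) (subst (d ∣_) n≡Q^1*PP d∣n))
  ...   | inj₁ refl        = contradiction 1<d (<-irrefl refl)
  ...   | inj₂ (inj₁ refl) = [p]
  ...   | inj₂ (inj₂ refl) = [pp]
  vertex⇒path-vertex {d} (1<d , d<n , d∣n) | yes (divides d′ refl)
    with ∣prime*prime prime-P (*-cancelʳ-∣ {d′} {P * P} Q d∣n)
  ...   | inj₁ refl        = subst PathVertex (sym (*-identityˡ Q)) [q]
  ...   | inj₂ (inj₁ refl) = [pq]
  ...   | inj₂ (inj₂ refl) = contradiction d<n (<-irrefl refl)

  swap : ℕ → ℕ
  swap = transpose P Q ∘ transpose (P * P) (P * Q)

  swap-p : swap P ≡ Q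
  swap-p = begin
    transpose P Q (transpose (P * P) (P * Q) P) ≡⟨ cong (transpose P Q) (transpose-other (<⇒≢ P<PP) (<⇒≢ P<PQ)) ⟩
    transpose P Q P                             ≡⟨ transpose-fromˡ P Q ⟩
    Q                                           ∎

  swap-q : swap Q ≡ P
  swap-q = begin
    transpose P Q (transpose (P * P) (P * Q) Q) ≡⟨ cong (transpose P Q) (transpose-other Q≢PP (<⇒≢ Q<PQ)) ⟩
    transpose P Q Q                             ≡⟨ transpose-fromʳ P≢Q ⟩
    P                                           ∎

  swap-pp : swap (P * P) ≡ P * Q
  swap-pp = begin
    transpose P Q (transpose (P * P) (P * Q) (P * P)) ≡⟨ cong (transpose P Q) (transpose-fromˡ (P * P) (P * Q)) ⟩
    transpose P Q (P * Q)                             ≡⟨ transpose-other (>⇒≢ P<PQ) (>⇒≢ Q<PQ) ⟩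
    P * Q                                             ∎

  swap-pq : swap (P * Q) ≡ P * P
  swap-pq = begin
    transpose P Q (transpose (P * P) (P * Q) (P * Q)) ≡⟨ cong (transpose P Q) (transpose-fromʳ PP≢PQ) ⟩
    transpose P Q (P * P)                             ≡⟨ transpose-other (>⇒≢ P<PP) (Q≢PP ∘ sym) ⟩
    P * P                                             ∎

  swap-path-vertex : PathVertex d → PathVertex (swap d)
  swap-path-vertex [p]  = subst PathVertex (sym swap-p) [q]
  swap-path-vertex [q]  = subst PathVertex (sym swap-q) [p]
  swap-path-vertex [pp] = subst PathVertex (sym swap-pp) [pq]
  swap-path-vertex [pq] = subst PathVertex (sym swap-pq) [pp]

  swap-involutive : PathVertex d → swap (swap d) ≡ d
  swap-involutive [p]  = trans (cong swap swap-p) swap-q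
  swap-involutive [q]  = trans (cong swap swap-q) swap-p
  swap-involutive [pp] = trans (cong swap swap-pp) swap-pq
  swap-involutive [pq] = trans (cong swap swap-pq) swap-pp

  adjacent-p-pq : Adjacent n P (P * Q)
  adjacent-p-pq = ∣-reflexive n≡P*PQ

  adjacent-q-pp : Adjacent n Q (P * P)
  adjacent-q-pp = ∣-reflexive (*-comm (P * P) Q)

  adjacent-pp-pq : Adjacent n (P * P) (P * Q)
  adjacent-pp-pq = subst (_∣ P * P * (P * Q)) (sym n≡P*PQ) (*-monoˡ-∣ {P} {P * P} (P * Q) (m∣m*n P))

  ¬adjacent-p-q : ¬ Adjacent n P Q
  ¬adjacent-p-q n∣PQ = prime∤1 prime-P (*-cancelˡ-∣ (P * Q) (subst₂ _∣_ n≡PQ*P (sym (*-identityʳ (P * Q))) n∣PQ))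

  ¬adjacent-p-pp : ¬ Adjacent n P (P * P)
  ¬adjacent-p-pp n∣P·PP =
    P≢Q (sym (prime∣prime⇒≡ prime-Q prime-P (*-cancelˡ-∣ (P * P) (subst (n ∣_) (*-comm P (P * P)) n∣P·PP))))

  ¬adjacent-q-pq : ¬ Adjacent n Q (P * Q)
  ¬adjacent-q-pq n∣Q·PQ =
    P≢Q (prime∣prime⇒≡ prime-P prime-Q (*-cancelˡ-∣ (P * Q) (subst₂ _∣_ n≡PQ*P (*-comm Q (P * Q)) n∣Q·PQ)))

  swap-adjacent : PathVertex u → PathVertex v → u ≢ v → Adjacent n u v → Adjacent n (swap u) (swap v)
  swap-adjacent [p]  [p]  p≢p _  = contradiction refl p≢p
  swap-adjacent [p]  [q]  _ adj  = contradiction adj ¬adjacent-p-q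
  swap-adjacent [p]  [pp] _ adj  = contradiction adj ¬adjacent-p-pp
  swap-adjacent [p]  [pq] _ _    = subst₂ (Adjacent n) (sym swap-p) (sym swap-pq) adjacent-q-pp
  swap-adjacent [q]  [p]  _ adj  = contradiction (adjacent-sym Q P adj) ¬adjacent-p-q
  swap-adjacent [q]  [q]  q≢q _  = contradiction refl q≢q
  swap-adjacent [q]  [pp] _ _    = subst₂ (Adjacent n) (sym swap-q) (sym swap-pp) adjacent-p-pq
  swap-adjacent [q]  [pq] _ adj  = contradiction adj ¬adjacent-q-pq
  swap-adjacent [pp] [p]  _ adj  = contradiction (adjacent-sym (P * P) P adj) ¬adjacent-p-pp
  swap-adjacent [pp] [q]  _ _    = subst₂ (Adjacent n) (sym swap-pp) (sym swap-q) (adjacent-sym P (P * Q) adjacent-p-pq)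
  swap-adjacent [pp] [pp] pp≢pp _ = contradiction refl pp≢pp
  swap-adjacent [pp] [pq] _ _    = subst₂ (Adjacent n) (sym swap-pp) (sym swap-pq) (adjacent-sym (P * P) (P * Q) adjacent-pp-pq)
  swap-adjacent [pq] [p]  _ _    = subst₂ (Adjacent n) (sym swap-pq) (sym swap-p) (adjacent-sym Q (P * P) adjacent-q-pp)
  swap-adjacent [pq] [q]  _ adj  = contradiction (adjacent-sym (P * Q) Q adj) ¬adjacent-q-pq
  swap-adjacent [pq] [pp] _ _    = subst₂ (Adjacent n) (sym swap-pq) (sym swap-pp) adjacent-pp-pq
  swap-adjacent [pq] [pq] pq≢pq _ = contradiction refl pq≢pq

  swap-involutive-vertex : Vertex d → swap (swap d) ≡ d
  swap-involutive-vertex = swap-involutive ∘ vertex⇒path-vertex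

  swap-vertex : Vertex d → Vertex (swap d)
  swap-vertex = path-vertex ∘ swap-path-vertex ∘ vertex⇒path-vertex

  swap-injective : Vertex u → Vertex v → swap u ≡ swap v → u ≡ v
  swap-injective {u} {v} u-vertex v-vertex swap-u≡swap-v = begin
    u               ≡⟨ swap-involutive-vertex u-vertex ⟨
    swap (swap u)   ≡⟨ cong swap swap-u≡swap-v ⟩
    swap (swap v)   ≡⟨ swap-involutive-vertex v-vertex ⟩
    v               ∎

  swap-isAutomorphism : IsAutomorphism n swap
  swap-isAutomorphism = record
    { maps-into  = λ _ → swap-vertex
    ; injective  = λ _ _ → swap-injective
    ; surjective = λ v v-vertex → swap v , swap-vertex v-vertex , swap-involutive-vertex v-vertex
    ; adjacency  = λ _ _ u-vertex v-vertex u≢v →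
        mk⇔ (swap-adjacent (vertex⇒path-vertex u-vertex) (vertex⇒path-vertex v-vertex) u≢v)
            (subst₂ (Adjacent n) (swap-involutive-vertex u-vertex) (swap-involutive-vertex v-vertex) ∘
             swap-adjacent (vertex⇒path-vertex (swap-vertex u-vertex)) (vertex⇒path-vertex (swap-vertex v-vertex))
                           (u≢v ∘ swap-injective u-vertex v-vertex))
    }

  swapping : Automorphism n
  swapping = swap , swap-isAutomorphism

  prime-path-vertex : PathVertex d → Prime d → d ≡ P ⊎ d ≡ Q
  prime-path-vertex [p]  _   = inj₁ refl
  prime-path-vertex [q]  _   = inj₂ refl
  prime-path-vertex [pp] pPP = contradiction (∣prime⇒≡ pPP (prime>1 prime-P) (m∣m*n P)) (<⇒≢ P<PP)
  prime-path-vertex [pq] pPQ = contradiction (∣prime⇒≡ pPQ (prime>1 prime-P) (m∣m*n Q)) (<⇒≢ P<PQ)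

  same-on-P-Q⇒SameAut : (f g : Automorphism n) → proj₁ f P ≡ proj₁ g P → proj₁ f Q ≡ proj₁ g Q → SameAut n f g
  same-on-P-Q⇒SameAut (σ , σ-automorphism) (τ , τ-automorphism) σP≡τP σQ≡τQ d d-vertex
    with vertex⇒path-vertex d-vertex
  ... | [p]  = σP≡τP
  ... | [q]  = σQ≡τQ
  ... | [pp] = same-on-complement σ-automorphism τ-automorphism (path-vertex [pp]) (path-vertex [q]) refl σQ≡τQ
  ... | [pq] = same-on-complement σ-automorphism τ-automorphism (path-vertex [pq]) (path-vertex [p]) (sym n≡PQ*P) σP≡τP

  image-of-prime : ∀ {σ} → IsAutomorphism n σ → PathVertex d → Prime d → σ d ≡ P ⊎ σ d ≡ Q
  image-of-prime σ-automorphism d-path d-prime =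
    prime-path-vertex (vertex⇒path-vertex (σ-vertex (path-vertex d-path))) (prime-preserved (path-vertex d-path) d-prime)
    where
    open Automorphism σ-automorphism

  image-of-P≢image-of-Q : ∀ {σ} → IsAutomorphism n σ → σ P ≢ σ Q
  image-of-P≢image-of-Q σ-automorphism =
    P≢Q ∘ IsAutomorphism.injective σ-automorphism P Q (path-vertex [p]) (path-vertex [q])

  automorphism-cases : (f : Automorphism n) → SameAut n f (identity n) ⊎ SameAut n f swapping
  automorphism-cases f@(σ , σ-automorphism)
    with image-of-prime σ-automorphism [p] prime-P | image-of-prime σ-automorphism [q] prime-Q
  ... | inj₁ σP≡P | inj₂ σQ≡Q = inj₁ (same-on-P-Q⇒SameAut f (identity n) σP≡P σQ≡Q)
  ... | inj₂ σP≡Q | inj₁ σQ≡P =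
    inj₂ (same-on-P-Q⇒SameAut f swapping (trans σP≡Q (sym swap-p)) (trans σQ≡P (sym swap-q)))
  ... | inj₁ σP≡P | inj₁ σQ≡P = contradiction (trans σP≡P (sym σQ≡P)) (image-of-P≢image-of-Q σ-automorphism)
  ... | inj₂ σP≡Q | inj₂ σQ≡Q = contradiction (trans σP≡Q (sym σQ≡Q)) (image-of-P≢image-of-Q σ-automorphism)

  autGroupOrder2 : AutGroupOrder n 2
  autGroupOrder2 = automorphisms , distinct , λ f → Sum.[ (zero ,_) , (suc zero ,_) ]′ (automorphism-cases f)
    where
    open F using (zero; suc)
    automorphisms : Vec (Automorphism n) 2
    automorphisms = identity n ∷ swapping ∷ []
    distinct : ∀ i j → i ≢ j → ¬ SameAut n (lookup automorphisms i) (lookup automorphisms j)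
    distinct zero       zero       i≢j _    = i≢j refl
    distinct zero       (suc zero) _   same = P≢Q (trans (same P (path-vertex [p])) swap-p)
    distinct (suc zero) zero       _   same = P≢Q (trans (sym (same P (path-vertex [p]))) swap-p)
    distinct (suc zero) (suc zero) i≢j _    = i≢j refl

-- Pairwise distinct exponents

module DistinctExponents {n k : ℕ} (h : 2 ≤ k) (p α : Fin k → ℕ) (primes : ∀ i → Prime (p i))
                         (p-injective : ∀ i j → p i ≡ p j → i ≡ j)
                         (α-decreasing : ∀ i j → i F.< j → α j < α i) (α-positive : ∀ i → 1 ≤ α i)
                         (n≡∏ : n ≡ ∏ (λ i → p i ^ α i)) where

  i₁ i₂ : Fin k
  i₁ = idx₁ h
  i₂ = idx₂ h

  toℕ-i₁ : F.toℕ i₁ ≡ 0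
  toℕ-i₁ = Fin.toℕ-fromℕ< _

  toℕ-i₂ : F.toℕ i₂ ≡ 1
  toℕ-i₂ = Fin.toℕ-fromℕ< _

  i₁≢i₂ : i₁ ≢ i₂
  i₁≢i₂ i₁≡i₂ = 0≢1+n (trans (sym toℕ-i₁) (trans (cong F.toℕ i₁≡i₂) toℕ-i₂))

  p₁≢p₂ : p i₁ ≢ p i₂
  p₁≢p₂ = i₁≢i₂ ∘ p-injective i₁ i₂

  instance
    n≢0 : NonZero n
    n≢0 = >-nonZero (subst (0 <_) (sym n≡∏) (∏^>0 p α primes))

  p^j∣n : ∀ i → j ≤ α i → p i ^ j ∣ n
  p^j∣n i j≤αᵢ = subst (_ ∣_) (sym n≡∏) (∣-trans (^-monoʳ-∣ (p i) j≤αᵢ) (^∣∏^ p α i))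

  p∣n : ∀ i → p i ∣ n
  p∣n i = subst (_∣ n) (*-identityʳ (p i)) (p^j∣n i (α-positive i))

  prime∣n⇒index : Prime t → t ∣ n → ∃[ i ] t ≡ p i
  prime∣n⇒index pt t∣n = prime∣∏^⇒≡ p α primes pt (subst (_ ∣_) n≡∏ t∣n)

  exponent-bound : ∀ i → p i ^ e ∣ n → e ≤ α i
  exponent-bound i p^e∣n = ^∣∏^⇒≤ p α primes p-injective i (subst (_ ∣_) n≡∏ p^e∣n)

  open ProperDivisorGraph n (primes i₁) (primes i₂) p₁≢p₂ (p∣n i₁) (p∣n i₂)

  p^j-vertex : ∀ i → 1 ≤ j → j ≤ α i → Vertex (p i ^ j)
  p^j-vertex i 1≤j j≤αᵢ = prime-power-vertex (primes i) 1≤j (p^j∣n i j≤αᵢ)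

  p-vertex : ∀ i → Vertex (p i)
  p-vertex i = prime-vertex (primes i) (p∣n i)

  p-of-cofactor : ∀ i → n ≡ p i ^ a * c → Prime c → ∀ {x} → x ≢ i → p x ≡ c
  p-of-cofactor {a} {c} i n≡pᵢ^a*c pc {x} x≢i
    with euclidsLemma (p i ^ a) c (primes x) (subst (p x ∣_) n≡pᵢ^a*c (p∣n x))
  ... | inj₁ pₓ∣pᵢ^a = contradiction (p-injective x i (prime∣^⇒≡ a (primes x) (primes i) pₓ∣pᵢ^a)) x≢i
  ... | inj₂ pₓ∣c    = prime∣prime⇒≡ (primes x) pc pₓ∣c

  prime-cofactor⇒exceptional : ∀ i m → i F.< m → n ≡ p i ^ α i * c → Prime c →
                               (∀ {j} → 1 ≤ j → j < α i → j ≤ α m) → n ≡ p i₁ ^ 2 * p i₂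
  prime-cofactor⇒exceptional {c} i m i<m n≡pᵢ^αᵢ*c pc below =
    trans n≡pᵢ^αᵢ*c (cong₂ _*_ (cong₂ _^_ (cong p i≡i₁) αᵢ≡2) (sym pᵢ₂≡c))
    where
    m≢i : m ≢ i
    m≢i refl = <-irrefl refl i<m
    p-other : ∀ {x} → x ≢ i → p x ≡ c
    p-other = p-of-cofactor {α i} i n≡pᵢ^αᵢ*c pc
    i≡i₁ : i ≡ i₁
    i≡i₁ with i₁ F.≟ i
    ... | yes i₁≡i = sym i₁≡i
    ... | no  i₁≢i = contradiction (subst (F.toℕ i <_) toℕ-m≡0 i<m) λ ()
      where
      toℕ-m≡0 : F.toℕ m ≡ 0
      toℕ-m≡0 = trans (cong F.toℕ (p-injective m i₁ (trans (p-other m≢i) (sym (p-other i₁≢i))))) toℕ-i₁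
    pᵢ₂≡c : p i₂ ≡ c
    pᵢ₂≡c = p-other λ i₂≡i → i₁≢i₂ (trans (sym i≡i₁) (sym i₂≡i))
    αₘ≤1 : α m ≤ 1
    αₘ≤1 = ^∣^*⇒≤ (primes m) pₘ∤pᵢ^αᵢ (subst (p m ^ α m ∣_) n≡pₘ^1*pᵢ^αᵢ (p^j∣n m ≤-refl))
      where
      pₘ∤pᵢ^αᵢ : ¬ p m ∣ p i ^ α i
      pₘ∤pᵢ^αᵢ = m≢i ∘ p-injective m i ∘ prime∣^⇒≡ (α i) (primes m) (primes i)
      n≡pₘ^1*pᵢ^αᵢ : n ≡ p m ^ 1 * p i ^ α i
      n≡pₘ^1*pᵢ^αᵢ = trans n≡pᵢ^αᵢ*c (trans (*-comm (p i ^ α i) c)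
                       (cong (_* p i ^ α i) (trans (sym (p-other m≢i)) (sym (*-identityʳ (p m))))))
    αᵢ≡2 : α i ≡ 2
    αᵢ≡2 = ≤-antisym (≮⇒≥ λ 2<αᵢ → contradiction (≤-trans (below (s≤s z≤n) 2<αᵢ) αₘ≤1) λ { (s≤s ()) })
                     (≤-trans (s≤s (α-positive m)) (α-decreasing i m i<m))

  module _ {σ : ℕ → ℕ} (σ-automorphism : IsAutomorphism n σ) where
    open Automorphism σ-automorphism

    σ-power-below-top : ∀ i → 1 ≤ j → j < α i → ∃[ e ] σ (p i ^ j) ≡ σ (p i) ^ e
    σ-power-below-top {j} i 1≤j j<αᵢ =
      σ-prime-power (primes i) 1≤j (p^j-vertex i 1≤j (<⇒≤ j<αᵢ))
        (λ pᵢ^j*c≡n pc → ^*prime≢n {j = j} (primes i) pc (p^j∣n i j<αᵢ) pᵢ^j*c≡n)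

    exponent-of-image : ∀ i m → σ (p i) ≡ p m → 1 ≤ j → j ≤ α i →
                        (∀ {j′} → 1 ≤ j′ → j′ ≤ j → ∃[ e ] σ (p i ^ j′) ≡ σ (p i) ^ e) → j ≤ α m
    exponent-of-image i m σpᵢ≡pₘ 1≤j j≤αᵢ powers
      with σ-prime-power-exponent (primes i) 1≤j (p^j-vertex i 1≤j j≤αᵢ) powers
    ... | e , σx≡σpᵢ^e , j≤e =
      ≤-trans j≤e (exponent-bound m (subst₂ _∣_ (trans σx≡σpᵢ^e (cong (_^ e) σpᵢ≡pₘ)) refl
                                                (vertex∣n (σ-vertex (p^j-vertex i 1≤j j≤αᵢ)))))

    exponent-below-top-of-image : ∀ i m → σ (p i) ≡ p m → 1 ≤ j → j < α i → j ≤ α m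
    exponent-below-top-of-image i m σpᵢ≡pₘ 1≤j j<αᵢ =
      exponent-of-image i m σpᵢ≡pₘ 1≤j (<⇒≤ j<αᵢ)
        (λ 1≤j′ j′≤j → σ-power-below-top i 1≤j′ (≤-<-trans j′≤j j<αᵢ))

    index-increase⇒exceptional : ∀ i m → σ (p i) ≡ p m → i F.< m → n ≡ p i₁ ^ 2 * p i₂
    index-increase⇒exceptional i m σpᵢ≡pₘ i<m with complement (p^j-vertex i (α-positive i) ≤-refl)
    ... | c , _ , pᵢ^αᵢ*c≡n with prime? c
    ... | yes pc = prime-cofactor⇒exceptional i m i<m (sym pᵢ^αᵢ*c≡n) pc (exponent-below-top-of-image i m σpᵢ≡pₘ)
    ... | no ¬pc =
      contradiction (exponent-of-image i m σpᵢ≡pₘ (α-positive i) ≤-refl powers) (<⇒≱ (α-decreasing i m i<m))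
      where
      x-vertex : Vertex (p i ^ α i)
      x-vertex = p^j-vertex i (α-positive i) ≤-refl
      powers : ∀ {j} → 1 ≤ j → j ≤ α i → ∃[ e ] σ (p i ^ j) ≡ σ (p i) ^ e
      powers 1≤j j≤αᵢ with m≤n⇒m<n∨m≡n j≤αᵢ
      ... | inj₁ j<αᵢ = σ-power-below-top i 1≤j j<αᵢ
      ... | inj₂ refl = σ-prime-power (primes i) 1≤j x-vertex
                          λ pᵢ^αᵢ*c′≡n → ¬pc ∘ subst Prime (complement-unique x-vertex pᵢ^αᵢ*c′≡n pᵢ^αᵢ*c≡n)

    module _ (n≢p₁²p₂ : n ≢ p i₁ ^ 2 * p i₂) where

      σ-fixes-primes : ∀ i → σ (p i) ≡ p i
      σ-fixes-primes i = fixed i (Fin-<-wellFounded i)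
        where
        fixed : ∀ i → Acc F._<_ i → σ (p i) ≡ p i
        fixed i (acc smaller)
          with prime∣n⇒index (prime-preserved (p-vertex i) (primes i)) (vertex∣n (σ-vertex (p-vertex i)))
        ... | m , σpᵢ≡pₘ with <-cmp (F.toℕ i) (F.toℕ m)
        ... | tri< i<m _ _ = contradiction (index-increase⇒exceptional i m σpᵢ≡pₘ i<m) n≢p₁²p₂
        ... | tri≈ _ i≡m _ = trans σpᵢ≡pₘ (cong p (sym (Fin.toℕ-injective i≡m)))
        ... | tri> _ _ m<i = contradiction (cong F.toℕ m≡i) (<⇒≢ m<i)
          where
          m≡i : m ≡ i
          m≡i = p-injective m i (σ-injective (p-vertex m) (p-vertex i) (trans (fixed m (smaller m<i)) (sym σpᵢ≡pₘ)))

      σ-fixes-prime-powers : ∀ i j → 1 ≤ j → j ≤ α i → σ (p i ^ j) ≡ p i ^ j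
      σ-fixes-prime-powers i = <-rec _ fixed
        where
        fixed : ∀ j → (∀ {j′} → j′ < j → 1 ≤ j′ → j′ ≤ α i → σ (p i ^ j′) ≡ p i ^ j′) →
                1 ≤ j → j ≤ α i → σ (p i ^ j) ≡ p i ^ j
        fixed j fixed-below 1≤j j≤αᵢ = fixed-given-complement (complement x-vertex)
          where
          x-vertex : Vertex (p i ^ j)
          x-vertex = p^j-vertex i 1≤j j≤αᵢ
          fixed-given-complement : ∃[ c ] Vertex c × p i ^ j * c ≡ n → σ (p i ^ j) ≡ p i ^ j
          fixed-given-complement (c , c-vertex , x*c≡n) with prime? c
          ... | yes pc =
            *-cancelʳ-≡ (σ (p i ^ j)) (p i ^ j) c {{vertex≢0 c-vertex}}
              (trans (subst (λ d → σ (p i ^ j) * d ≡ n) σc≡c (complement-preserved x-vertex c-vertex x*c≡n))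
                     (sym x*c≡n))
            where
            σc≡c : σ c ≡ c
            σc≡c with prime∣n⇒index pc (vertex∣n c-vertex)
            ... | l , refl = σ-fixes-primes l
          ... | no ¬pc with σ-prime-power-exponent (primes i) 1≤j x-vertex powers
            where
            powers : ∀ {j′} → 1 ≤ j′ → j′ ≤ j → ∃[ e ] σ (p i ^ j′) ≡ σ (p i) ^ e
            powers {j′} 1≤j′ j′≤j with m≤n⇒m<n∨m≡n j′≤j
            ... | inj₁ j′<j =
              j′ , trans (fixed-below j′<j 1≤j′ (≤-trans j′≤j j≤αᵢ)) (cong (_^ j′) (sym (σ-fixes-primes i)))
            ... | inj₂ refl = σ-prime-power (primes i) 1≤j′ x-vertex
                                λ x*c′≡n → ¬pc ∘ subst Prime (complement-unique x-vertex x*c′≡n x*c≡n)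
          ...   | e , σx≡σpᵢ^e , j≤e =
            σ-fixes-power-above (primes i) x-vertex (trans σx≡σpᵢ^e (cong (_^ e) (σ-fixes-primes i))) j≤e
              (λ j′<j 1≤j′ → fixed-below j′<j 1≤j′ (≤-trans (<⇒≤ j′<j) j≤αᵢ))

      σ-fixes-vertices : Vertex d → σ d ≡ d
      σ-fixes-vertices = fixing-prime-powers⇒fixing-vertices fixes
        where
        fixes : ∀ t e → Prime t → 1 ≤ e → t ^ e ∣ n → σ (t ^ e) ≡ t ^ e
        fixes t e pt 1≤e t^e∣n with prime∣n⇒index pt (∣-trans (m∣m^n t 1≤e) t^e∣n)
        ... | l , refl = σ-fixes-prime-powers l e 1≤e (exponent-bound l t^e∣n)

corollary4p5 : (n k : ℕ) (h : 2 ≤ k) (p α : Fin k → ℕ) →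
    (∀ i → Prime (p i)) →
    (∀ i j → p i ≡ p j → i ≡ j) →
    (∀ i j → i F.< j → α j < α i) →
    (∀ i → 1 ≤ α i) →
    n ≡ ∏ (λ i → p i ^ α i) →
    (n ≡ p (idx₁ h) ^ 2 * p (idx₂ h) → AutGroupOrder n 2) ×
    (n ≢ p (idx₁ h) ^ 2 * p (idx₂ h) → AutGroupOrder n 1)
corollary4p5 n k h p α primes p-injective α-decreasing α-positive n≡∏ = exceptional , generic
  where
  open DistinctExponents {n} h p α primes p-injective α-decreasing α-positive n≡∏

  exceptional : n ≡ p i₁ ^ 2 * p i₂ → AutGroupOrder n 2
  exceptional n≡p₁²p₂ = subst (λ m → AutGroupOrder m 2) (sym n≡p₁p₁p₂)
                          (ProperDivisorGraphOfP²Q.autGroupOrder2 (primes i₁) (primes i₂) p₁≢p₂)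
    where
    n≡p₁p₁p₂ : n ≡ p i₁ * p i₁ * p i₂
    n≡p₁p₁p₂ = trans n≡p₁²p₂ (cong (_* p i₂) (m^2≡m*m (p i₁)))

  generic : n ≢ p i₁ ^ 2 * p i₂ → AutGroupOrder n 1
  generic n≢p₁²p₂ = rigid⇒autGroupOrder1 λ (σ , σ-automorphism) _ → σ-fixes-vertices σ-automorphism n≢p₁²p₂
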